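{- Let $Q\subseteq\mathbb{F}_2^m$ and $R\subseteq\mathbb{F}_2^n$, and let $Q\oplus R:=\{\mathbf{u}\mathbf{v}\mid \mathbf{u}\in Q,\ \mathbf{v}\in R\}\subseteq\mathbb{F}_2^{m+n}$, where $\mathbf{u}\mathbf{v}$ denotes concatenation. Then $Q\oplus R$ is a powerful set if and only if both $Q$ and $R$ are powerful sets.
   Context: A set $S\subseteq\mathbb{F}_2^n$ (positions indexed by $[n]$) is a powerful set if for every $X\subseteq[n]$ the number of vectors in $S$ that are zero in all positions of $X$ is a power of $2$. -}

module Defs where

open import Data.Bool using (Bool; true; false; _∧_; not)
open import Data.Nat using (ℕ; zero; suc; _+_; _^_)
open import Data.List using (List; []; _∷_; map; _++_; filterᵇ; length)
open import Data.Vec using (Vec; []; _∷_; take; drop)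
open import Data.Fin.Subset using (Subset)
open import Data.Product using (∃)
open import Relation.Binary.PropositionalEquality using (_≡_)
open import Function using (_⇔_)

-- A subset of F_2^n, given by its characteristic function
-- (vectors of F_2^n are Vec Bool n, with true = 1, false = 0).
F2Set : ℕ → Set
F2Set n = Vec Bool n → Bool

allVecs : (n : ℕ) → List (Vec Bool n)
allVecs zero = [] ∷ []
allVecs (suc n) = map (false ∷_) (allVecs n) ++ map (true ∷_) (allVecs n)

zeroOn : ∀ {n} → Subset n → Vec Bool n → Bool
zeroOn [] [] = true
zeroOn (x ∷ X) (b ∷ v) = not (x ∧ b) ∧ zeroOn X v

countZeroOn : ∀ {n} → F2Set n → Subset n → ℕ
countZeroOn {n} S X = length (filterᵇ (λ v → S v ∧ zeroOn X v) (allVecs n))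

IsPowerOfTwo : ℕ → Set
IsPowerOfTwo k = ∃ λ e → k ≡ 2 ^ e

Powerful : ∀ {n} → F2Set n → Set
Powerful {n} S = (X : Subset n) → IsPowerOfTwo (countZeroOn S X)

_⊕_ : ∀ {m n} → F2Set m → F2Set n → F2Set (m + n)
_⊕_ {m} Q R w = Q (take m w) ∧ R (drop m w)

-- Counting the vectors of Q ⊕ R that vanish on X ++ Y splits into independent choices of the
-- two halves, so that count is the product of the corresponding counts for Q on X and R on Y.
-- A product of powers of two is a power of two, and conversely each factor of a power of two
-- is one (2 is prime); taking Y or X empty recovers the counts of Q and R alone.
module Submission where

open import Defs

open import Algebra.Bundles using (CommutativeMonoid)
open import Data.Bool using (Bool; true; false; _∧_; not; T; T?)
open import Data.Bool.Properties using (∧-assoc; ∧-commutativeMonoid)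
open import Algebra.Properties.CommutativeSemigroup
  (CommutativeMonoid.commutativeSemigroup ∧-commutativeMonoid) using () renaming (interchange to ∧-interchange)
open import Data.Fin.Subset using (Subset; ⊥)
open import Data.List using ([]; _∷_; map; _++_; filterᵇ; length)
open import Data.List.Properties using (filter-++; filter-≐; filter-none; length-++)
open import Data.List.Relation.Unary.All using (universal)
open import Data.Nat using (ℕ; suc; _+_; _*_; _^_)
open import Data.Nat.Divisibility using (divides)
open import Data.Nat.Primality using (euclidsLemma; prime[2])
open import Data.Nat.Properties
  using (*-comm; *-assoc; *-distribʳ-+; *-cancelʳ-≡; +-identityʳ; m*n≡1⇒m≡1; ^-distribˡ-+-*)
open import Data.Product using (_×_; _,_)
open import Data.Sum using (inj₁; inj₂)
open import Data.Vec using (Vec; take; drop) renaming (_++_ to _+++_; _∷_ to _∷ᵛ_; [] to []ᵛ)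
open import Data.Vec.Properties using (take++drop≡id)
open import Function using (_⇔_; _∘_; mk⇔)
open import Relation.Binary.PropositionalEquality
  using (_≡_; refl; sym; trans; cong; cong₂; subst; module ≡-Reasoning)

isPowerOfTwo-* : ∀ {a b} → IsPowerOfTwo a → IsPowerOfTwo b → IsPowerOfTwo (a * b)
isPowerOfTwo-* (i , refl) (j , refl) = i + j , sym (^-distribˡ-+-* 2 i j)

private
  halve : ∀ x e → x * 2 ≡ 2 ^ suc e → x ≡ 2 ^ e
  halve x e eq = *-cancelʳ-≡ x (2 ^ e) 2 (trans eq (*-comm 2 (2 ^ e)))

*≡2^⇒isPowerOfTwoˡ : ∀ a b e → a * b ≡ 2 ^ e → IsPowerOfTwo a
*≡2^⇒isPowerOfTwoˡ a b 0 eq = 0 , m*n≡1⇒m≡1 a b eq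
*≡2^⇒isPowerOfTwoˡ a b (suc e) eq
  with euclidsLemma a b prime[2] (divides (2 ^ e) (trans eq (*-comm 2 (2 ^ e))))
... | inj₁ (divides a′ refl) =
  let k , a′≡2^k = *≡2^⇒isPowerOfTwoˡ a′ b e (halve (a′ * b) e a′b2≡2^1+e)
  in suc k , trans (cong (_* 2) a′≡2^k) (*-comm (2 ^ k) 2)
  where
  a′b2≡2^1+e : a′ * b * 2 ≡ 2 ^ suc e
  a′b2≡2^1+e = begin
    a′ * b * 2   ≡⟨ *-assoc a′ b 2 ⟩
    a′ * (b * 2) ≡⟨ cong (a′ *_) (*-comm b 2) ⟩
    a′ * (2 * b) ≡⟨ sym (*-assoc a′ 2 b) ⟩
    a′ * 2 * b   ≡⟨ eq ⟩
    2 ^ suc e    ∎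
    where open ≡-Reasoning
... | inj₂ (divides b′ refl) =
  *≡2^⇒isPowerOfTwoˡ a b′ e (halve (a * b′) e (trans (*-assoc a b′ 2) eq))

isPowerOfTwo-*⁻ˡ : ∀ a b → IsPowerOfTwo (a * b) → IsPowerOfTwo a
isPowerOfTwo-*⁻ˡ a b (e , eq) = *≡2^⇒isPowerOfTwoˡ a b e eq

isPowerOfTwo-*⁻ʳ : ∀ a b → IsPowerOfTwo (a * b) → IsPowerOfTwo b
isPowerOfTwo-*⁻ʳ a b = isPowerOfTwo-*⁻ˡ b a ∘ subst IsPowerOfTwo (*-comm a b)

module _ {A : Set} where

  length-filterᵇ-++ : ∀ (p : A → Bool) xs ys →
    length (filterᵇ p (xs ++ ys)) ≡ length (filterᵇ p xs) + length (filterᵇ p ys)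
  length-filterᵇ-++ p xs ys = trans (cong length (filter-++ (T? ∘ p) xs ys)) (length-++ (filterᵇ p xs))

  length-filterᵇ-map : ∀ {B : Set} (p : B → Bool) (f : A → B) xs →
    length (filterᵇ p (map f xs)) ≡ length (filterᵇ (p ∘ f) xs)
  length-filterᵇ-map p f []       = refl
  length-filterᵇ-map p f (x ∷ xs) with p (f x)
  ... | true  = cong suc (length-filterᵇ-map p f xs)
  ... | false = length-filterᵇ-map p f xs

  length-filterᵇ-cong : ∀ {p q : A → Bool} → (∀ x → p x ≡ q x) → ∀ xs →
    length (filterᵇ p xs) ≡ length (filterᵇ q xs)
  length-filterᵇ-cong p≗q xs = cong length
    (filter-≐ (T? ∘ _) (T? ∘ _) ((λ {x} → subst T (p≗q x)) , (λ {x} → subst T (sym (p≗q x)))) xs)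

  length-filterᵇ-false : ∀ xs → length (filterᵇ (λ (_ : A) → false) xs) ≡ 0
  length-filterᵇ-false xs = cong length (filter-none (T? ∘ _) (universal (λ _ ()) xs))

count : ∀ {n} → (Vec Bool n → Bool) → ℕ
count {n} p = length (filterᵇ p (allVecs n))

count-cong : ∀ {n} {p q : Vec Bool n → Bool} → (∀ v → p v ≡ q v) → count p ≡ count q
count-cong {n} p≗q = length-filterᵇ-cong p≗q (allVecs n)

count-suc : ∀ {n} (p : Vec Bool (suc n) → Bool) →
  count p ≡ count (p ∘ (false ∷ᵛ_)) + count (p ∘ (true ∷ᵛ_))
count-suc {n} p =
  trans (length-filterᵇ-++ p (map (false ∷ᵛ_) (allVecs n)) (map (true ∷ᵛ_) (allVecs n)))
        (cong₂ _+_ (length-filterᵇ-map p (false ∷ᵛ_) (allVecs n))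
                   (length-filterᵇ-map p (true ∷ᵛ_) (allVecs n)))

count-split : ∀ m n (f : Vec Bool m → Bool) (g : Vec Bool n → Bool) →
  count (λ w → f (take m w) ∧ g (drop m w)) ≡ count f * count g
count-split 0 n f g with f []ᵛ
... | true  = sym (+-identityʳ (count g))
... | false = length-filterᵇ-false (allVecs n)
count-split (suc m) n f g = begin
  count (λ w → f (take (suc m) w) ∧ g (drop (suc m) w))
    ≡⟨ count-suc {m + n} _ ⟩
  count (λ w → f (false ∷ᵛ take m w) ∧ g (drop m w)) + count (λ w → f (true ∷ᵛ take m w) ∧ g (drop m w))
    ≡⟨ cong₂ _+_ (count-split m n _ g) (count-split m n _ g) ⟩
  count (f ∘ (false ∷ᵛ_)) * count g + count (f ∘ (true ∷ᵛ_)) * count g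
    ≡⟨ sym (*-distribʳ-+ (count g) (count (f ∘ (false ∷ᵛ_))) (count (f ∘ (true ∷ᵛ_)))) ⟩
  (count (f ∘ (false ∷ᵛ_)) + count (f ∘ (true ∷ᵛ_))) * count g
    ≡⟨ cong (_* count g) (sym (count-suc f)) ⟩
  count f * count g ∎
  where open ≡-Reasoning

zeroOn-++ : ∀ {m n} (X : Subset m) (Y : Subset n) w →
  zeroOn (X +++ Y) w ≡ zeroOn X (take m w) ∧ zeroOn Y (drop m w)
zeroOn-++ []ᵛ               Y w          = refl
zeroOn-++ {suc m} (x ∷ᵛ X) Y (b ∷ᵛ w) =
  trans (cong (not (x ∧ b) ∧_) (zeroOn-++ X Y w))
        (sym (∧-assoc (not (x ∧ b)) (zeroOn X (take m w)) (zeroOn Y (drop m w))))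

countZeroOn-⊕ : ∀ {m n} (Q : F2Set m) (R : F2Set n) X Y →
  countZeroOn (Q ⊕ R) (X +++ Y) ≡ countZeroOn Q X * countZeroOn R Y
countZeroOn-⊕ {m} {n} Q R X Y =
  trans (count-cong split) (count-split m n (λ u → Q u ∧ zeroOn X u) (λ v → R v ∧ zeroOn Y v))
  where
  split : ∀ w → (Q ⊕ R) w ∧ zeroOn (X +++ Y) w
              ≡ (Q (take m w) ∧ zeroOn X (take m w)) ∧ (R (drop m w) ∧ zeroOn Y (drop m w))
  split w = trans (cong ((Q ⊕ R) w ∧_) (zeroOn-++ X Y w))
                  (∧-interchange (Q (take m w)) (R (drop m w)) _ _)

theorem9 : (m n : ℕ) (Q : F2Set m) (R : F2Set n) →
    Powerful (Q ⊕ R) ⇔ (Powerful Q × Powerful R)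
theorem9 m n Q R = mk⇔ restrict extend
  where
  powerful-on : (X : Subset m) (Y : Subset n) → Powerful (Q ⊕ R) →
                IsPowerOfTwo (countZeroOn Q X * countZeroOn R Y)
  powerful-on X Y P = subst IsPowerOfTwo (countZeroOn-⊕ Q R X Y) (P (X +++ Y))

  restrict : Powerful (Q ⊕ R) → Powerful Q × Powerful R
  restrict P = (λ X → isPowerOfTwo-*⁻ˡ _ _ (powerful-on X ⊥ P))
             , (λ Y → isPowerOfTwo-*⁻ʳ (countZeroOn Q ⊥) _ (powerful-on ⊥ Y P))

  extend : Powerful Q × Powerful R → Powerful (Q ⊕ R)
  extend (PQ , PR) Z = subst (IsPowerOfTwo ∘ countZeroOn (Q ⊕ R)) (take++drop≡id m Z)
    (subst IsPowerOfTwo (sym (countZeroOn-⊕ Q R (take m Z) (drop m Z)))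
      (isPowerOfTwo-* (PQ (take m Z)) (PR (drop m Z))))
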